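{- Let $K \ge 2$ and $N \ge 2$ be integers with $K < T_{\text{ideal}} := \lceil \log_2(N+1) \rceil$, and let $T^* = \min\{T \in \mathbb{N} : E(T,K) \ge N\}$, where $E(T,K) = \sum_{i=1}^{K} \binom{T}{i}$. Run Phase 2 of the procedure described in the context on input $(K,N)$, and let $T_{\text{cached}}$ be the value of the variable $T_{\text{cached}}$ when Phase 2 terminates. Then $T_{\text{cached}} < T^* \le T_{\text{cached}} + K$.
   Context: Generalized egg dropping problem: with $K$ identical test items and $N$ floors, $E(T,K) = \sum_{i=1}^{K}\binom{T}{i}$ (with $\binom{T}{i}=0$ for $i>T$) is the maximum number of floors that can be handled by $T$ tests in the worst case, and $T^* = \min\{T \in \mathbb{N} : E(T,K) \ge N\}$ is the minimum worst-case number of tests. Phase 2 of the procedure (run when $K < T_{\text{ideal}} = \lceil \log_2(N+1)\rceil$): set $L \gets 1$, $R \gets 2^{\lceil T_{\text{ideal}}/K \rceil}$, $E_{\text{cached}} \gets 0$, $B_{\text{cached}} \gets 1$, $T_{\text{cached}} \gets K$. While $L < R$: set $M_{\text{mid}} \gets \lfloor (L+R)/2 \rfloor$, $E_{\text{mid}} \gets 0$, $\text{term} \gets 1$, $T_{\text{mid}} \gets K M_{\text{mid}}$; for $i = 1, \dots, K$: set $\text{term} \gets \text{term}\cdot(T_{\text{mid}} - i + 1)/i$ (exact integer division), $E_{\text{mid}} \gets E_{\text{mid}} + \text{term}$, and if $E_{\text{mid}} \ge N$ exit the for-loop. After the for-loop: if $E_{\text{mid}} \ge N$ set $R \gets M_{\text{mid}}$;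 otherwise set $L \gets M_{\text{mid}}+1$, $E_{\text{cached}} \gets E_{\text{mid}}$, $B_{\text{cached}} \gets \text{term}$, $T_{\text{cached}} \gets T_{\text{mid}}$. -}

module Defs where

open import Data.Nat using (ℕ; zero; suc; _+_; _*_; _∸_; _^_; _≤_; _<_; _≥_; _≤ᵇ_; _<ᵇ_; _/_)
open import Data.Nat.Combinatorics using (_C_)
open import Data.Nat.Logarithm using (⌈log₂_⌉)
open import Data.Bool using (Bool; true; false; if_then_else_)
open import Data.Product using (_×_; _,_; proj₁; proj₂)

-- E(T,K) = Σ_{i=1}^{K} (T choose i)   (stdlib's T C i is 0 for i > T)
E : ℕ → ℕ → ℕ
E T zero    = 0
E T (suc k) = E T k + T C (suc k)

Tideal : ℕ → ℕ
Tideal N = ⌈log₂ (suc N) ⌉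

-- ceiling division a/b for b = suc b'
ceilDiv : ℕ → ℕ → ℕ
ceilDiv a b' = (a + b') / suc b'

IsMinTests : ℕ → ℕ → ℕ → Set
IsMinTests K N T = (E T K ≥ N) × (∀ T' → E T' K ≥ N → T ≤ T')

-- Inner for-loop of Phase 2.
-- State: (E_mid, term). Iterates i = i0, i0+1, ..., K (fuel = remaining iterations).
-- term ← term * (T - i + 1) / i ; E ← E + term ; if E ≥ N exit.
-- Note T = K * M_mid ≥ K ≥ i, so T - i + 1 is never truncated.
innerLoop : (N T : ℕ) → (fuel i : ℕ) → ℕ → ℕ → ℕ × ℕ
innerLoop N T zero       i Em term = Em , term
innerLoop N T (suc fuel) zero Em term = Em , term   -- unreachable (i ≥ 1)
innerLoop N T (suc fuel) (suc j) Em term =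
  let term' = (term * (T ∸ suc j + 1)) / suc j
      Em'   = Em + term'
  in if N ≤ᵇ Em' then (Em' , term')
     else innerLoop N T fuel (suc (suc j)) Em' term'

-- Loop state: (L , R , E_cached , B_cached , T_cached)
record State : Set where
  constructor st
  field
    L R Ec Bc Tc : ℕ

-- Outer binary-search while-loop, with fuel. Each iteration strictly
-- decreases R - L, so fuel = R - L (initial) suffices.
outerLoop : (K N : ℕ) → (fuel : ℕ) → State → State
outerLoop K N zero s = s
outerLoop K N (suc fuel) (st L R Ec Bc Tc) =
  if L <ᵇ R then
    (let M    = (L + R) / 2
         T    = K * M
         res  = innerLoop N T K 1 0 1
         Em   = proj₁ res
         term = proj₂ res
     in if N ≤ᵇ Em then outerLoop K N fuel (st L M Ec Bc Tc)
        else outerLoop K N fuel (st (suc M) R Em term T))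
  else st L R Ec Bc Tc

-- Initial state of Phase 2: L=1, R=2^⌈T_ideal/K⌉, E_cached=0, B_cached=1, T_cached=K
phase2Init : ℕ → ℕ → State
phase2Init K N = st 1 (2 ^ ceilDiv (Tideal N) (K ∸ 1)) 0 1 K

phase2 : ℕ → ℕ → State
phase2 K N = outerLoop K N (State.R (phase2Init K N)) (phase2Init K N)

Tcached : ℕ → ℕ → ℕ
Tcached K N = State.Tc (phase2 K N)

{-# OPTIONS --safe #-}
module Submission where

open import Defs
open import Data.Nat using (ℕ; _+_; _≤_; _<_)
open import Data.Product using (_×_)

open import Data.Nat
  using (zero; suc; _*_; _∸_; _^_; _≤ᵇ_; _<ᵇ_; _≤′_; ≤′-refl; ≤′-step; z≤n; s≤s; z<s; s≤s⁻¹; ⌈_/2⌉)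
open import Data.Nat.Properties
open import Data.Nat.Combinatorics using (_C_; nC1≡n; nCk+nC[k+1]≡[n+1]C[k+1])
open import Data.Nat.DivMod using (_/_; _%_; m*n/n≡m; /-monoˡ-≤; m<n*o⇒m/o<n; m≡m%n+[m/n]*n; m%n<n)
open import Data.Nat.Logarithm using (⌈log₂_⌉; ⌈log₂⌉-mono-≤; ⌈log₂2^n⌉≡n)
open import Data.Nat.Logarithm.Core using (⌈log2⌉)
open import Data.Nat.Induction using (<-wellFounded)
open import Data.Nat.Tactic.RingSolver using (solve-∀)
open import Data.Product using (_,_; proj₁)
open import Data.Bool using (true; false)
open import Function.Base using (_∘_)
open import Function.Bundles using (_⇔_; mk⇔; Equivalence)
open import Function.Construct.Identity using (⇔-id)
open import Induction.WellFounded using (Acc; acc)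
open import Relation.Nullary.Reflects using (ofʸ; ofⁿ)
open import Relation.Binary.PropositionalEquality

-- Phase 2 only tests multiples T = K * M. Its inner loop decides E(T, K) ≥ N correctly, since the
-- absorption identity (j + 1) C(T, j + 1) = (T - j) C(T, j) makes every division exact. The
-- binary search keeps T_cached failing (E < N), K * R succeeding (E ≥ N) and K * L ≤ T_cached + K;
-- it stops with R ≤ L, and E being monotone in T then puts T* in (T_cached, T_cached + K].
-- Initially T_cached = K fails because 1 + E(K, K) = 2^K ≤ N, and K * 2^⌈T_ideal/K⌉ succeeds
-- because (1 + m)^K ≤ 1 + E(K m, K): picking at most one element from each of K blocks of size
-- m picks at most K elements of a K m-set.

C-absorption : ∀ T j → T * (T C j) ≡ j * (T C j) + suc j * (T C suc j)
C-absorption zero    zero    = refl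
C-absorption zero    (suc j) = sym (cong₂ _+_ (*-zeroʳ (suc j)) (*-zeroʳ (suc (suc j))))
C-absorption (suc T) zero    = trans (*-identityʳ (suc T)) (sym (trans (*-identityˡ _) (nC1≡n (suc T))))
C-absorption (suc T) (suc j) = begin
  suc T * (suc T C suc j)                            ≡⟨ cong (suc T *_) (sym (pascal j)) ⟩
  suc T * (a + b)                                    ≡⟨ distrib T a b ⟩
  (a + b) + (T * a + T * b)                          ≡⟨ cong ((a + b) +_) (cong₂ _+_ (C-absorption T j) (C-absorption T (suc j))) ⟩
  (a + b) + ((j * a + suc j * b) + (suc j * b + suc (suc j) * c))
                                                     ≡⟨ regroup j a b c ⟩
  suc j * (a + b) + suc (suc j) * (b + c)            ≡⟨ cong₂ (λ x y → suc j * x + suc (suc j) * y) (pascal j) (pascal (suc j)) ⟩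
  suc j * (suc T C suc j) + suc (suc j) * (suc T C suc (suc j)) ∎
  where
  open ≡-Reasoning
  pascal = nCk+nC[k+1]≡[n+1]C[k+1] T
  a = T C j
  b = T C suc j
  c = T C suc (suc j)
  distrib : ∀ T a b → suc T * (a + b) ≡ (a + b) + (T * a + T * b)
  distrib = solve-∀
  regroup : ∀ j a b c → (a + b) + ((j * a + suc j * b) + (suc j * b + suc (suc j) * c))
                        ≡ suc j * (a + b) + suc (suc j) * (b + c)
  regroup = solve-∀

C-absorption-∸ : ∀ {T j} → j ≤ T → (T C j) * (T ∸ j) ≡ suc j * (T C suc j)
C-absorption-∸ {T} {j} j≤T = +-cancelˡ-≡ (j * (T C j)) _ _ (begin
  j * (T C j) + (T C j) * (T ∸ j)   ≡⟨ cong (j * (T C j) +_) (*-comm (T C j) (T ∸ j)) ⟩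
  j * (T C j) + (T ∸ j) * (T C j)   ≡⟨ *-distribʳ-+ (T C j) j (T ∸ j) ⟨
  (j + (T ∸ j)) * (T C j)           ≡⟨ cong (_* (T C j)) (m+[n∸m]≡n j≤T) ⟩
  T * (T C j)                       ≡⟨ C-absorption T j ⟩
  j * (T C j) + suc j * (T C suc j) ∎)
  where open ≡-Reasoning

C-step : ∀ {T j} → suc j ≤ T → (T C j) * (T ∸ suc j + 1) / suc j ≡ T C suc j
C-step {T} {j} j<T = begin
  (T C j) * (T ∸ suc j + 1) / suc j ≡⟨ cong (λ d → (T C j) * d / suc j) (trans (+-comm (T ∸ suc j) 1) (sym (+-∸-assoc 1 j<T))) ⟩
  (T C j) * (T ∸ j) / suc j         ≡⟨ cong (_/ suc j) (trans (C-absorption-∸ (<⇒≤ j<T)) (*-comm (suc j) _)) ⟩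
  (T C suc j) * suc j / suc j       ≡⟨ m*n/n≡m (T C suc j) (suc j) ⟩
  T C suc j                         ∎
  where open ≡-Reasoning

C-≤-suc : ∀ T k → T C k ≤ suc T C k
C-≤-suc T zero    = ≤-refl
C-≤-suc T (suc k) = ≤-trans (m≤n+m (T C suc k) (T C k)) (≤-reflexive (nCk+nC[k+1]≡[n+1]C[k+1] T k))

C-monoˡ-≤ : ∀ {T T′} k → T ≤ T′ → T C k ≤ T′ C k
C-monoˡ-≤ k T≤T′ = go (≤⇒≤′ T≤T′)
  where
  go : ∀ {T T′} → T ≤′ T′ → T C k ≤ T′ C k
  go ≤′-refl        = ≤-refl
  go (≤′-step T≤T′) = ≤-trans (go T≤T′) (C-≤-suc _ k)

E-monoˡ-≤ : ∀ {T T′} K → T ≤ T′ → E T K ≤ E T′ K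
E-monoˡ-≤ zero    T≤T′ = ≤-refl
E-monoˡ-≤ (suc K) T≤T′ = +-mono-≤ (E-monoˡ-≤ K T≤T′) (C-monoˡ-≤ (suc K) T≤T′)

E-monoʳ-≤ : ∀ T {j k} → j ≤ k → E T j ≤ E T k
E-monoʳ-≤ T j≤k = go (≤⇒≤′ j≤k)
  where
  go : ∀ {j k} → j ≤′ k → E T j ≤ E T k
  go ≤′-refl        = ≤-refl
  go (≤′-step j≤k) = ≤-trans (go j≤k) (m≤m+n _ _)

-- Σ_{i=0}^{K} (T choose i), the number of subsets of size at most K of a T-element set.
E₀ : ℕ → ℕ → ℕ
E₀ T K = suc (E T K)

E₀-rec : ∀ T K → E₀ (suc T) (suc K) ≡ E₀ T (suc K) + E₀ T K
E₀-rec T zero    = cong suc (trans (nC1≡n (suc T)) (trans (+-comm 1 T) (cong (_+ 1) (sym (nC1≡n T)))))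
E₀-rec T (suc K) = begin
  E₀ (suc T) (suc K) + suc T C suc (suc K)
    ≡⟨ cong₂ _+_ (E₀-rec T K) (sym (nCk+nC[k+1]≡[n+1]C[k+1] T (suc K))) ⟩
  (E₀ T (suc K) + E₀ T K) + (T C suc K + T C suc (suc K))
    ≡⟨ regroup (E₀ T (suc K)) (E₀ T K) (T C suc K) (T C suc (suc K)) ⟩
  E₀ T (suc (suc K)) + E₀ T (suc K) ∎
  where
  open ≡-Reasoning
  regroup : ∀ a b x y → (a + b) + (x + y) ≡ (a + y) + (b + x)
  regroup = solve-∀

E-zeroˡ : ∀ K → E 0 K ≡ 0
E-zeroˡ zero    = refl
E-zeroˡ (suc K) = trans (+-identityʳ (E 0 K)) (E-zeroˡ K)

E₀-full : ∀ {T K} → T ≤ K → E₀ T K ≡ 2 ^ T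
E₀-full {zero}  {K}     _         = cong suc (E-zeroˡ K)
E₀-full {suc T} {suc K} (s≤s T≤K) = begin
  E₀ (suc T) (suc K)        ≡⟨ E₀-rec T K ⟩
  E₀ T (suc K) + E₀ T K     ≡⟨ cong₂ _+_ (E₀-full (m≤n⇒m≤1+n T≤K)) (E₀-full T≤K) ⟩
  2 ^ T + 2 ^ T             ≡⟨ cong (2 ^ T +_) (+-identityʳ (2 ^ T)) ⟨
  2 ^ suc T                 ∎
  where open ≡-Reasoning

E₀-*-≤ : ∀ a b j k → E₀ a j * E₀ b k ≤ E₀ (a + b) (j + k)
E₀-*-≤ zero b j k = begin
  E₀ 0 j * E₀ b k ≡⟨ cong (λ n → suc n * E₀ b k) (E-zeroˡ j) ⟩
  1 * E₀ b k      ≡⟨ *-identityˡ (E₀ b k) ⟩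
  E₀ b k          ≤⟨ s≤s (E-monoʳ-≤ b (m≤n+m k j)) ⟩
  E₀ b (j + k)    ∎
  where open ≤-Reasoning
E₀-*-≤ (suc a) b zero k = begin
  1 * E₀ b k         ≡⟨ *-identityˡ (E₀ b k) ⟩
  E₀ b k             ≤⟨ s≤s (E-monoˡ-≤ k (m≤n+m b (suc a))) ⟩
  E₀ (suc a + b) k   ∎
  where open ≤-Reasoning
E₀-*-≤ (suc a) b (suc j) k = begin
  E₀ (suc a) (suc j) * E₀ b k                        ≡⟨ cong (_* E₀ b k) (E₀-rec a j) ⟩
  (E₀ a (suc j) + E₀ a j) * E₀ b k                   ≡⟨ *-distribʳ-+ (E₀ b k) (E₀ a (suc j)) (E₀ a j) ⟩
  E₀ a (suc j) * E₀ b k + E₀ a j * E₀ b k            ≤⟨ +-mono-≤ (E₀-*-≤ a b (suc j) k) (E₀-*-≤ a b j k) ⟩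
  E₀ (a + b) (suc j + k) + E₀ (a + b) (j + k)        ≡⟨ E₀-rec (a + b) (j + k) ⟨
  E₀ (suc a + b) (suc j + k)                         ∎
  where open ≤-Reasoning

[1+m]^k≤E₀[k*m]k : ∀ m k → suc m ^ k ≤ E₀ (k * m) k
[1+m]^k≤E₀[k*m]k m zero    = ≤-refl
[1+m]^k≤E₀[k*m]k m (suc k) = begin
  suc m * suc m ^ k          ≡⟨ cong (λ n → suc n * suc m ^ k) (nC1≡n m) ⟨
  E₀ m 1 * suc m ^ k         ≤⟨ *-monoʳ-≤ (E₀ m 1) ([1+m]^k≤E₀[k*m]k m k) ⟩
  E₀ m 1 * E₀ (k * m) k      ≤⟨ E₀-*-≤ m (k * m) 1 k ⟩
  E₀ (suc k * m) (suc k)     ∎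
  where open ≤-Reasoning

n≤2*⌈n/2⌉ : ∀ n → n ≤ 2 * ⌈ n /2⌉
n≤2*⌈n/2⌉ zero          = z≤n
n≤2*⌈n/2⌉ (suc zero)    = s≤s z≤n
n≤2*⌈n/2⌉ (suc (suc n)) = ≤-trans (s≤s (s≤s (n≤2*⌈n/2⌉ n))) (≤-reflexive (sym (*-suc 2 ⌈ n /2⌉)))

n≤2^⌈log2⌉n : ∀ n (rec : Acc _<_ n) → n ≤ 2 ^ ⌈log2⌉ n rec
n≤2^⌈log2⌉n zero          _        = z≤n
n≤2^⌈log2⌉n (suc zero)    _        = s≤s z≤n
n≤2^⌈log2⌉n (suc (suc n)) (acc rs) =
  ≤-trans (n≤2*⌈n/2⌉ (suc (suc n))) (*-monoʳ-≤ 2 (n≤2^⌈log2⌉n (suc ⌈ n /2⌉) (rs (⌈n/2⌉<n n))))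

n≤2^⌈log₂n⌉ : ∀ n → n ≤ 2 ^ ⌈log₂ n ⌉
n≤2^⌈log₂n⌉ n = n≤2^⌈log2⌉n n (<-wellFounded n)

m≤ceilDiv[m,k]*[1+k] : ∀ m k → m ≤ ceilDiv m k * suc k
m≤ceilDiv[m,k]*[1+k] m k = +-cancelʳ-≤ k m (q * suc k) (begin
  m + k                     ≡⟨ m≡m%n+[m/n]*n (m + k) (suc k) ⟩
  (m + k) % suc k + q * suc k ≤⟨ +-monoˡ-≤ (q * suc k) (s≤s⁻¹ (m%n<n (m + k) (suc k))) ⟩
  k + q * suc k             ≡⟨ +-comm k (q * suc k) ⟩
  q * suc k + k             ∎)
  where
  open ≤-Reasoning
  q = ceilDiv m k

N≤E[K*2^⌈Tideal/K⌉] : ∀ k N → N ≤ E (suc k * 2 ^ ceilDiv (Tideal N) k) (suc k)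
N≤E[K*2^⌈Tideal/K⌉] k N = s≤s⁻¹ (begin
  suc N                           ≤⟨ n≤2^⌈log₂n⌉ (suc N) ⟩
  2 ^ Tideal N                    ≤⟨ ^-monoʳ-≤ 2 (m≤ceilDiv[m,k]*[1+k] (Tideal N) k) ⟩
  2 ^ (c * suc k)                 ≡⟨ ^-*-assoc 2 c (suc k) ⟨
  (2 ^ c) ^ suc k                 ≤⟨ ^-monoˡ-≤ (suc k) (n≤1+n (2 ^ c)) ⟩
  suc (2 ^ c) ^ suc k             ≤⟨ [1+m]^k≤E₀[k*m]k (2 ^ c) (suc k) ⟩
  E₀ (suc k * 2 ^ c) (suc k)      ∎)
  where
  open ≤-Reasoning
  c = ceilDiv (Tideal N) k

E[K,K]<N : ∀ {K N} → K < Tideal N → E K K < N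
E[K,K]<N {K} {N} K<Tideal = ≰⇒> λ N≤E[K,K] → <⇒≱ K<Tideal (begin
  ⌈log₂ suc N ⌉    ≤⟨ ⌈log₂⌉-mono-≤ (s≤s N≤E[K,K]) ⟩
  ⌈log₂ E₀ K K ⌉   ≡⟨ cong ⌈log₂_⌉ (E₀-full {K} ≤-refl) ⟩
  ⌈log₂ 2 ^ K ⌉    ≡⟨ ⌈log₂2^n⌉≡n K ⟩
  K                ∎)
  where open ≤-Reasoning

module _ {N T K : ℕ} (K≤T : K ≤ T) where

  private
    index<K : ∀ {fuel j} → suc fuel + j ≡ K → j < K
    index<K {j = j} 1+fuel+j≡K = subst (j <_) 1+fuel+j≡K (m<n+m j z<s)

  -- Loop invariant (via C-step): on entering index j + 1, `E_mid` is E T j and `term` is T C j.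
  innerLoop-≥⇔ : ∀ fuel j → fuel + j ≡ K →
                 (N ≤ proj₁ (innerLoop N T fuel (suc j) (E T j) (T C j))) ⇔ (N ≤ E T K)
  innerLoop-≥⇔ zero       j refl = ⇔-id _
  innerLoop-≥⇔ (suc fuel) j 1+fuel+j≡K
    rewrite C-step {T} {j} (<-≤-trans (index<K 1+fuel+j≡K) K≤T)
    with N ≤ᵇ E T (suc j) | ≤ᵇ-reflects-≤ N (E T (suc j))
  ... | true  | ofʸ N≤E[1+j] = mk⇔ (λ _ → ≤-trans N≤E[1+j] (E-monoʳ-≤ T (index<K 1+fuel+j≡K))) (λ _ → N≤E[1+j])
  ... | false | ofⁿ _         = innerLoop-≥⇔ fuel (suc j) (trans (+-suc fuel j) 1+fuel+j≡K)

L≤[L+R]/2 : ∀ {L R} → L < R → L ≤ (L + R) / 2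
L≤[L+R]/2 {L} {R} L<R = begin
  L            ≡⟨ m*n/n≡m L 2 ⟨
  L * 2 / 2    ≡⟨ cong (_/ 2) (trans (*-comm L 2) (cong (L +_) (+-identityʳ L))) ⟩
  (L + L) / 2  ≤⟨ /-monoˡ-≤ 2 (+-monoʳ-≤ L (<⇒≤ L<R)) ⟩
  (L + R) / 2  ∎
  where open ≤-Reasoning

[L+R]/2<R : ∀ {L R} → L < R → (L + R) / 2 < R
[L+R]/2<R {L} {R} L<R = m<n*o⇒m/o<n (begin-strict
  L + R        <⟨ +-monoˡ-< R L<R ⟩
  R + R        ≡⟨ trans (*-comm R 2) (cong (R +_) (+-identityʳ R)) ⟨
  R * 2        ∎)
  where open ≤-Reasoning

innerLoop-test⇔ : ∀ {N K M} → 1 ≤ M → (N ≤ proj₁ (innerLoop N (K * M) K 1 0 1)) ⇔ (N ≤ E (K * M) K)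
innerLoop-test⇔ {K = K} 1≤M =
  innerLoop-≥⇔ (≤-trans (≤-reflexive (sym (*-identityʳ K))) (*-monoʳ-≤ K 1≤M)) K 0 (+-identityʳ K)

-- K * L ≤ Tc + K holds because every upper-half step sets Tc = K * (L - 1).
record Bracket (K N : ℕ) (s : State) : Set where
  open State s
  field
    1≤L       : 1 ≤ L
    N≤E[K*R]  : N ≤ E (K * R) K
    E[Tc]<N   : E Tc K < N
    K*L≤Tc+K  : K * L ≤ Tc + K

module _ {K N L R Ec Bc Tc : ℕ} (b : Bracket K N (st L R Ec Bc Tc)) (L<R : L < R) where

  open Bracket b

  private
    M = (L + R) / 2

  1≤M : 1 ≤ M
  1≤M = ≤-trans 1≤L (L≤[L+R]/2 L<R)

  Bracket-lower : N ≤ E (K * M) K → Bracket K N (st L M Ec Bc Tc)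
  Bracket-lower N≤E[K*M] = record
    { 1≤L = 1≤L ; N≤E[K*R] = N≤E[K*M] ; E[Tc]<N = E[Tc]<N ; K*L≤Tc+K = K*L≤Tc+K }

  Bracket-upper : ∀ {Ec′ Bc′} → E (K * M) K < N → Bracket K N (st (suc M) R Ec′ Bc′ (K * M))
  Bracket-upper E[K*M]<N = record
    { 1≤L = s≤s z≤n ; N≤E[K*R] = N≤E[K*R] ; E[Tc]<N = E[K*M]<N
    ; K*L≤Tc+K = ≤-reflexive (trans (*-suc K M) (+-comm K (K * M))) }

closed-bracket : ∀ {K N s} → Bracket K N s → State.R s ≤ State.L s →
                 E (State.Tc s) K < N × N ≤ E (State.Tc s + K) K
closed-bracket {K} b R≤L =
  E[Tc]<N , ≤-trans N≤E[K*R] (E-monoˡ-≤ K (≤-trans (*-monoʳ-≤ K R≤L) K*L≤Tc+K))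
  where open Bracket b

outerLoop-bracket : ∀ {K N} fuel s → Bracket K N s → State.R s ≤ State.L s + fuel →
                    let s′ = outerLoop K N fuel s in
                    E (State.Tc s′) K < N × N ≤ E (State.Tc s′ + K) K
outerLoop-bracket zero s b R≤L+0 = closed-bracket b (≤-trans R≤L+0 (≤-reflexive (+-identityʳ _)))
outerLoop-bracket {K} {N} (suc fuel) (st L R Ec Bc Tc) b R≤L+1+fuel
  with L <ᵇ R | <ᵇ-reflects-< L R
... | false | ofⁿ L≮R = closed-bracket b (≮⇒≥ L≮R)
... | true  | ofʸ L<R
  with N ≤ᵇ proj₁ (innerLoop N (K * ((L + R) / 2)) K 1 0 1)
     | ≤ᵇ-reflects-≤ N (proj₁ (innerLoop N (K * ((L + R) / 2)) K 1 0 1))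
... | true  | ofʸ N≤Em =
  outerLoop-bracket fuel _ (Bracket-lower b L<R (Equivalence.to (innerLoop-test⇔ {K = K} (1≤M b L<R)) N≤Em))
    (s≤s⁻¹ (≤-trans ([L+R]/2<R L<R) (≤-trans R≤L+1+fuel (≤-reflexive (+-suc L fuel)))))
... | false | ofⁿ N≰Em =
  outerLoop-bracket fuel _ (Bracket-upper b L<R (≰⇒> (N≰Em ∘ Equivalence.from (innerLoop-test⇔ {K = K} (1≤M b L<R)))))
    (≤-trans R≤L+1+fuel (≤-trans (+-monoˡ-≤ (suc fuel) (L≤[L+R]/2 L<R)) (≤-reflexive (+-suc _ fuel))))

phase2Init-bracket : ∀ {k N} → suc k < Tideal N → Bracket (suc k) N (phase2Init (suc k) N)
phase2Init-bracket {k} {N} K<Tideal = record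
  { 1≤L = ≤-refl ; N≤E[K*R] = N≤E[K*2^⌈Tideal/K⌉] k N ; E[Tc]<N = E[K,K]<N K<Tideal
  ; K*L≤Tc+K = ≤-trans (≤-reflexive (*-identityʳ (suc k))) (m≤m+n (suc k) (suc k)) }

phase2-bracket : ∀ {K N} → 1 ≤ K → K < Tideal N → E (Tcached K N) K < N × N ≤ E (Tcached K N + K) K
phase2-bracket {suc k} _ K<Tideal = outerLoop-bracket _ _ (phase2Init-bracket K<Tideal) (n≤1+n _)

lemma1 : (K N : ℕ) → 2 ≤ K → 2 ≤ N → K < Tideal N →
         (Tstar : ℕ) → IsMinTests K N Tstar →
         (Tcached K N < Tstar) × (Tstar ≤ Tcached K N + K)
lemma1 K N 2≤K _ K<Tideal Tstar (N≤E[T*] , T*-least)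
  with phase2-bracket (<⇒≤ 2≤K) K<Tideal
... | E[Tc]<N , N≤E[Tc+K] =
  ≰⇒> (λ T*≤Tc → <⇒≱ E[Tc]<N (≤-trans N≤E[T*] (E-monoˡ-≤ K T*≤Tc))) , T*-least _ N≤E[Tc+K]
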